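{- Let $\sigma$ be a complete ordering of $r$ modes. Among all minimum-length sequences of $\textsc{PartialSort}$ calls that transform lists of $r$-coordinates sorted under the simple ordering $(1,2,\ldots,r)$ into lists sorted under $\sigma$, the sequence of calls made by $\textsc{QuesadillaSort}(\cdot,\sigma)$ has the minimum number of bucketed partial sorts (calls $\textsc{PartialSort}(A,(\psi_1,\ldots,\psi_l),\psi_k)$ with $l\ge1$).
   Context: An $r$-coordinate is a tuple $(i_1,\ldots,i_r)$ of integers with $1\le i_m\le n_m$; position $m$ is mode $m$. A complete ordering is a tuple of all $r$ modes in some order (a permutation of $(1,\ldots,r)$). Coordinates are compared lexicographically under an ordering $\sigma$: $i<i'$ if $i_{\sigma_1}<i'_{\sigma_1}$, or $i_{\sigma_1}=i'_{\sigma_1}$ and $i<i'$ under $(\sigma_2,\ldots)$; all tuples are equal under $()$. A list is sorted under $\sigma$ if nondecreasing in this order. For $A$ sorted under a complete ordering $\psi$ and $0\le l<k\le r$, $\textsc{PartialSort}(A,(\psi_1,\ldots,\psi_l),\psi_k)$ returns the coordinates of $A$ rearranged to be sorted under $(\psi_1,\ldots,\psi_l,\psi_k,\psi_{l+1},\ldots,\psi_{k-1},\psi_{k+1},\ldots,\psi_r)$; the call is non-bucketed if $l=0$ and bucketed if $l\ge1$. A sequence of $\textsc{PartialSort}$ calls consists of statements $A\gets\textsc{PartialSort}(A,(\psi_1,\ldots,\psi_l),\psi_k)$ with $k>l\ge0$, where $\psi$ is the current complete ordering of $A$ (initially $(1,\ldots,r)$, and updated after each call to the output ordering above). For a complete ordering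 $\tau$ and mode $p=\tau_k$, $f(\tau,p)=\{\tau_{k+1},\ldots,\tau_r\}$. $\textsc{QuesadillaSort}(A,\sigma)$ is the procedure (indices 1-based): set $l\gets0$; while $l<r$: set $k\gets l$; while $k+1<r$ and $f(\sigma,\sigma_{k+1})\not\subseteq f((1,2,\ldots,r),\sigma_{k+1})$, set $k\gets k+1$; set $l'\gets k+1$; while $k>l$: set $A\gets\textsc{PartialSort}(A,(\sigma_1,\ldots,\sigma_l),\sigma_k)$ and $k\gets k-1$; then set $l\gets l'$. Finally return $A$. -}

module Defs where

open import Data.Nat using (ℕ; zero; suc; _∸_; _<ᵇ_; _≡ᵇ_; _≤_; _≟_)
open import Data.Bool using (Bool; true; false; if_then_else_; not; _∧_)
open import Data.List using (List; []; _∷_; _++_; take; drop; length; map; upTo)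
open import Data.Bool.ListAction using (all; any)
open import Data.List.Membership.Propositional using (_∈_)
open import Data.Product using (_×_; _,_; proj₁)
open import Data.Unit using (⊤)
open import Relation.Binary.PropositionalEquality using (_≡_)

-- A mode is a natural number in 1..r; a (complete) ordering is a list of modes.

simple : ℕ → List ℕ
simple r = map suc (upTo r)

-- A PartialSort call  PartialSort(A, (ψ_1,…,ψ_l), p) : the prefix (ψ_1,…,ψ_l)
-- together with the mode p that is moved to position l+1.
Call : Set
Call = List ℕ × ℕ

removeFirst : ℕ → List ℕ → List ℕ
removeFirst p [] = []
removeFirst p (x ∷ xs) = if x ≡ᵇ p then xs else x ∷ removeFirst p xs

-- The ordering of the output of PartialSort(A,(ψ_1..ψ_l),ψ_k) when A is sorted
-- under ψ:  (ψ_1..ψ_l, ψ_k, ψ_{l+1}..ψ_{k-1}, ψ_{k+1}..ψ_r).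
step : List ℕ → Call → List ℕ
step ψ (P , p) = take (length P) ψ ++ p ∷ removeFirst p (drop (length P) ψ)

Legal : List ℕ → Call → Set
Legal ψ (P , p) = (take (length P) ψ ≡ P) × (p ∈ drop (length P) ψ)

LegalSeq : List ℕ → List Call → Set
LegalSeq ψ [] = ⊤
LegalSeq ψ (c ∷ cs) = Legal ψ c × LegalSeq (step ψ c) cs

run : List ℕ → List Call → List ℕ
run ψ [] = ψ
run ψ (c ∷ cs) = run (step ψ c) cs

Transforms : ℕ → List ℕ → List Call → Set
Transforms r σ cs = LegalSeq (simple r) cs × (run (simple r) cs ≡ σ)

bucketed : List Call → ℕ
bucketed [] = 0
bucketed ((P , p) ∷ cs) with length P
... | zero = bucketed cs
... | suc _ = suc (bucketed cs)

-- 0-based lookup with default: nth σ i = σ_{i+1}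
nth : List ℕ → ℕ → ℕ
nth [] i = 0
nth (x ∷ xs) zero = x
nth (x ∷ xs) (suc i) = nth xs i

f : List ℕ → ℕ → List ℕ
f [] p = []
f (x ∷ xs) p = if x ≡ᵇ p then xs else f xs p

elemᵇ : ℕ → List ℕ → Bool
elemᵇ x ys = any (λ y → x ≡ᵇ y) ys

subsetᵇ : List ℕ → List ℕ → Bool
subsetᵇ xs ys = all (λ x → elemᵇ x ys) xs

module Quesadilla (r : ℕ) (σ : List ℕ) where

  cond : ℕ → Bool
  cond k = not (subsetᵇ (f σ (nth σ k)) (f (simple r) (nth σ k)))

  scan : ℕ → ℕ → ℕ
  scan zero k = k
  scan (suc fuel) k = if (suc k <ᵇ r) ∧ cond k then scan fuel (suc k) else k

  emit : ℕ → ℕ → List Call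
  emit l zero = []
  emit l (suc k) = if l <ᵇ suc k then (take l σ , nth σ k) ∷ emit l k else []

  loop : ℕ → ℕ → List Call
  loop zero l = []
  loop (suc fuel) l =
    if l <ᵇ r then emit l (scan r l) ++ loop fuel (suc (scan r l)) else []

  calls : List Call
  calls = loop (suc r) 0

quesadillaCalls : ℕ → List ℕ → List Call
quesadillaCalls r σ = Quesadilla.calls r σ

{-# OPTIONS --safe #-}
-- Call a mode x needy if some mode after x in σ is smaller.  A mode that is never
-- moved keeps its order relative to every other mode, and (1, …, r) is increasing,
-- so every transforming sequence moves every needy mode and has at least as many
-- calls as there are needy modes.  In a sequence of exactly that length the calls
-- move distinct needy modes, so the mode 1, which is never needy, is never moved.
-- Then the last move of a needy mode x lying after 1 in σ must be bucketed: a
-- non-bucketed call would put x in front of 1 for good.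
-- QuesadillaSort meets both bounds.  Having fixed σ_1 … σ_l, its list is σ_1 … σ_l
-- followed by the remaining modes in increasing order.  A pass of the outer loop
-- moves the needy modes σ_{l+1} … σ_{l+m} once each, in reverse order, to the front
-- of that tail; the next mode σ_{l+m+1} is not needy, hence the least remaining mode,
-- and already stands in place.  Only the first pass, ending at 1, is non-bucketed.
module Submission where

open import Defs

open import Data.Bool using (true; false; not; T)
open import Data.Empty using (⊥)
open import Data.Nat using (ℕ; zero; suc; _+_; _≤_; _<_; _≡ᵇ_; _<ᵇ_; z≤n; s≤s)
open import Data.Nat.Properties
  using (_≟_; _<?_; <ᵇ-reflects-<; ≡ᵇ⇒≡; ≡⇒≡ᵇ; <⇒≢; <-irrefl; <-asym; <-cmp; ≤-trans; <⇒≤; ≤-reflexive;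
         ≤-pred; ≤-<-trans; <-≤-trans; ≤-antisym; ≮⇒≥; n≤1+n; m≤m+n; +-monoʳ-≤; m≤n⇒m⊓n≡m;
         +-suc; +-identityʳ; m≤n⇒m<n∨m≡n)
open import Data.List using (List; []; _∷_; _++_; [_]; take; drop; length; map; reverse; filter; upTo)
open import Data.List.Properties
  using (take++drop≡id; take-[]; take-all; drop-all; drop-drop; length-take; length-++; length-map;
         length-reverse; length-upTo; ++-assoc; ++-identityʳ; reverse-involutive; unfold-reverse;
         reverse-++; filter-++; filter-reject; filter-all)
open import Data.List.Membership.Propositional using (_∈_; _∉_; lose; find)
open import Data.List.Membership.Propositional.Properties using (∈-++⁺ˡ; ∈-++⁺ʳ; ∈-++⁻; ∈-filter⁻)
open import Data.List.Membership.DecPropositional _≟_ using (_∈?_)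
open import Data.List.Relation.Unary.Any using (Any; here; there; any?)
import Data.List.Relation.Unary.Any as Any
open import Data.List.Relation.Unary.Any.Properties using (any⁺; any⁻; reverse⁺; reverse⁻)
open import Data.List.Relation.Unary.All using (All; []; _∷_)
import Data.List.Relation.Unary.All as All
open import Data.List.Relation.Unary.All.Properties using (all⁺; all⁻)
import Data.List.Relation.Unary.All.Properties as Allₚ
open import Data.List.Relation.Unary.AllPairs using (AllPairs; []; _∷_)
import Data.List.Relation.Unary.AllPairs as AllPairs
import Data.List.Relation.Unary.AllPairs.Properties as AllPairsₚ
open import Data.List.Relation.Unary.Unique.Propositional using (Unique)
import Data.List.Relation.Unary.Unique.Propositional.Properties as Uniqueₚ
open import Data.List.Relation.Binary.Permutation.Propositional using (_↭_; ↭-sym; ↭⇒↭ₛ)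
open import Data.List.Relation.Binary.Permutation.Propositional.Properties using (∈-resp-↭; ↭-length; ↭-reverse)
import Data.List.Relation.Binary.Permutation.Setoid.Properties as Permₛ
open import Data.Product using (Σ-syntax; _×_; _,_; proj₁; proj₂)
open import Data.Sum using (_⊎_; inj₁; inj₂)
open import Data.Unit using (tt)
open import Function using (_∘_; _⇔_; mk⇔; Equivalence)
open import Relation.Binary.Definitions using (tri<; tri≈; tri>)
open import Relation.Binary.PropositionalEquality
  using (_≡_; _≢_; refl; sym; trans; cong; cong₂; subst; setoid; module ≡-Reasoning)
open import Relation.Nullary using (¬_; Dec; yes; no; does; proof; contradiction)
open import Relation.Nullary.Reflects using (Reflects; ofʸ; ofⁿ; fromEquivalence; det; ¬-reflects)

≡ᵇ-reflects-≡ : ∀ m n → Reflects (m ≡ n) (m ≡ᵇ n)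
≡ᵇ-reflects-≡ m n = proof (m ≟ n)

elemᵇ⇒∈ : ∀ {x} ys → T (elemᵇ x ys) → x ∈ ys
elemᵇ⇒∈ {x} ys t = Any.map (λ {y} → ≡ᵇ⇒≡ x y) (any⁻ _ ys t)

∈⇒elemᵇ : ∀ {x ys} → x ∈ ys → T (elemᵇ x ys)
∈⇒elemᵇ {x} x∈ys = any⁺ _ (Any.map (λ {y} → ≡⇒≡ᵇ x y) x∈ys)

subsetᵇ-reflects : ∀ xs ys → Reflects (All (_∈ ys) xs) (subsetᵇ xs ys)
subsetᵇ-reflects xs ys =
  fromEquivalence (λ t → All.map (elemᵇ⇒∈ ys) (all⁺ _ xs t)) (λ xs⊆ys → all⁻ _ (All.map ∈⇒elemᵇ xs⊆ys))

Increasing : List ℕ → Set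
Increasing = AllPairs _<_

increasing⇒unique : ∀ {xs} → Increasing xs → Unique xs
increasing⇒unique = AllPairs.map <⇒≢

unique-resp-↭ : ∀ {xs ys : List ℕ} → xs ↭ ys → Unique xs → Unique ys
unique-resp-↭ xs↭ys = Permₛ.Unique-resp-↭ (setoid ℕ) (↭⇒↭ₛ xs↭ys)

unique-++-disjoint : ∀ (xs : List ℕ) {ys x} → Unique (xs ++ ys) → x ∈ xs → x ∉ ys
unique-++-disjoint (x ∷ xs) (x≢ ∷ _) (here refl) x∈ys = All.lookup (Allₚ.++⁻ʳ xs x≢) x∈ys refl
unique-++-disjoint (_ ∷ xs) (_ ∷ u) (there x∈xs) = unique-++-disjoint xs u x∈xs

take-length-++ : ∀ (xs ys : List ℕ) → take (length xs) (xs ++ ys) ≡ xs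
take-length-++ [] ys = refl
take-length-++ (x ∷ xs) ys = cong (x ∷_) (take-length-++ xs ys)

drop-length-++ : ∀ (xs ys : List ℕ) → drop (length xs) (xs ++ ys) ≡ ys
drop-length-++ [] ys = refl
drop-length-++ (x ∷ xs) ys = drop-length-++ xs ys

take-+ : ∀ l n (xs : List ℕ) → take (l + n) xs ≡ take l xs ++ take n (drop l xs)
take-+ zero n xs = refl
take-+ (suc l) n [] = sym (take-[] n)
take-+ (suc l) n (x ∷ xs) = cong (x ∷_) (take-+ l n xs)

<-length-drop : ∀ l m (xs : List ℕ) → l + m < length xs → m < length (drop l xs)
<-length-drop zero m xs l+m< = l+m<
<-length-drop (suc l) m (x ∷ xs) (s≤s l+m<) = <-length-drop l m xs l+m<

drop-nth : ∀ k (xs : List ℕ) → k < length xs → drop k xs ≡ nth xs k ∷ drop (suc k) xs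
drop-nth zero (x ∷ xs) _ = refl
drop-nth (suc k) (x ∷ xs) (s≤s k<n) = drop-nth k xs k<n

nth-drop : ∀ l i (xs : List ℕ) → nth (drop l xs) i ≡ nth xs (l + i)
nth-drop zero i xs = refl
nth-drop (suc l) i [] = refl
nth-drop (suc l) i (x ∷ xs) = nth-drop l i xs

take-suc-nth : ∀ k (xs : List ℕ) → k < length xs → take (suc k) xs ≡ take k xs ++ [ nth xs k ]
take-suc-nth zero (x ∷ xs) _ = refl
take-suc-nth (suc k) (x ∷ xs) (s≤s k<n) = cong (x ∷_) (take-suc-nth k xs k<n)

∈-removeFirst⁺ : ∀ {y p} xs → y ∈ xs → y ≢ p → y ∈ removeFirst p xs
∈-removeFirst⁺ {p = p} (x ∷ xs) y∈ y≢p with x ≡ᵇ p | ≡ᵇ-reflects-≡ x p | y∈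
... | true  | ofʸ refl  | here refl = contradiction refl y≢p
... | true  | ofʸ refl  | there y∈xs = y∈xs
... | false | ofⁿ _     | here refl = here refl
... | false | ofⁿ _     | there y∈xs = there (∈-removeFirst⁺ xs y∈xs y≢p)

∈-removeFirst⁻ : ∀ {y p} xs → y ∈ removeFirst p xs → y ∈ xs
∈-removeFirst⁻ {p = p} (x ∷ xs) y∈ with x ≡ᵇ p | y∈
... | true  | y∈xs = there y∈xs
... | false | here refl = here refl
... | false | there y∈ = there (∈-removeFirst⁻ xs y∈)

∈-removeFirst-≢ : ∀ {y p xs} → Unique xs → y ∈ removeFirst p xs → y ≢ p
∈-removeFirst-≢ {p = p} {x ∷ xs} (x∉xs ∷ u) y∈ with x ≡ᵇ p | ≡ᵇ-reflects-≡ x p | y∈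
... | true  | ofʸ refl  | y∈xs = λ { refl → All.lookup x∉xs y∈xs refl }
... | false | ofⁿ x≢p  | here refl = x≢p
... | false | ofⁿ _    | there y∈ = ∈-removeFirst-≢ u y∈

length-removeFirst : ∀ {p} xs → p ∈ xs → suc (length (removeFirst p xs)) ≡ length xs
length-removeFirst {p} (x ∷ xs) p∈ with x ≡ᵇ p | ≡ᵇ-reflects-≡ x p | p∈
... | true  | _        | _ = refl
... | false | ofⁿ x≢p  | here refl = contradiction refl x≢p
... | false | ofⁿ _    | there p∈xs = cong suc (length-removeFirst xs p∈xs)

removeFirst-++ : ∀ {p} (xs : List ℕ) ys → p ∉ xs → removeFirst p (xs ++ ys) ≡ xs ++ removeFirst p ys
removeFirst-++ [] ys p∉ = refl
removeFirst-++ {p} (x ∷ xs) ys p∉ with x ≡ᵇ p | ≡ᵇ-reflects-≡ x p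
... | true  | ofʸ refl = contradiction (here refl) p∉
... | false | ofⁿ _    = cong (x ∷_) (removeFirst-++ xs ys (p∉ ∘ there))

removeFirst⁺ : ∀ {R : ℕ → ℕ → Set} {p xs} → AllPairs R xs → AllPairs R (removeFirst p xs)
removeFirst⁺ [] = []
removeFirst⁺ {p = p} {x ∷ xs} (Rx ∷ Rxs) with x ≡ᵇ p
... | true  = Rxs
... | false = All.tabulate (All.lookup Rx ∘ ∈-removeFirst⁻ xs) ∷ removeFirst⁺ Rxs

unique-⊆⇒length≤ : ∀ {xs} ys → Unique xs → (∀ {x} → x ∈ xs → x ∈ ys) → length xs ≤ length ys
unique-⊆⇒length≤ ys [] _ = z≤n
unique-⊆⇒length≤ ys (_∷_ {x} x∉xs u) xs⊆ys =
  subst (_ ≤_) (length-removeFirst ys (xs⊆ys (here refl)))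
    (s≤s (unique-⊆⇒length≤ (removeFirst x ys) u
      (λ y∈xs → ∈-removeFirst⁺ ys (xs⊆ys (there y∈xs)) λ { refl → All.lookup x∉xs y∈xs refl })))

simple-increasing : ∀ r → Increasing (simple r)
simple-increasing r = AllPairsₚ.map⁺ (AllPairsₚ.applyUpTo⁺₁ (λ i → i) r (λ i<j _ → s≤s i<j))

simple-positive : ∀ r → All (0 <_) (simple r)
simple-positive r = Allₚ.map⁺ (Allₚ.applyUpTo⁺₂ (λ i → i) r (λ _ → s≤s z≤n))

1∈simple : ∀ {r} → 0 < r → 1 ∈ simple r
1∈simple {suc r} _ = here refl

length-simple : ∀ r → length (simple r) ≡ r
length-simple r = trans (length-map suc (upTo r)) (length-upTo r)

-- Relative order of modes

data Precedes (a b : ℕ) : List ℕ → Set where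
  front : ∀ {xs} → b ∈ xs → Precedes a b (a ∷ xs)
  later : ∀ {x xs} → Precedes a b xs → Precedes a b (x ∷ xs)

precedes⇒∈ˡ : ∀ {a b xs} → Precedes a b xs → a ∈ xs
precedes⇒∈ˡ (front _) = here refl
precedes⇒∈ˡ (later p) = there (precedes⇒∈ˡ p)

precedes⇒∈ʳ : ∀ {a b xs} → Precedes a b xs → b ∈ xs
precedes⇒∈ʳ (front b∈xs) = there b∈xs
precedes⇒∈ʳ (later p) = there (precedes⇒∈ʳ p)

precedes-asym : ∀ {a b xs} → Unique xs → Precedes a b xs → ¬ Precedes b a xs
precedes-asym (a∉ ∷ _) (front a∈xs) (front _) = All.lookup a∉ a∈xs refl
precedes-asym (a∉ ∷ _) (front _) (later p) = All.lookup a∉ (precedes⇒∈ʳ p) refl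
precedes-asym (b∉ ∷ _) (later p) (front _) = All.lookup b∉ (precedes⇒∈ʳ p) refl
precedes-asym (_ ∷ u) (later p) (later q) = precedes-asym u p q

increasing⇒precedes : ∀ {a b xs} → Increasing xs → a ∈ xs → b ∈ xs → a < b → Precedes a b xs
increasing⇒precedes _ (here refl) (here refl) a<b = contradiction a<b (<-irrefl refl)
increasing⇒precedes _ (here refl) (there b∈xs) _ = front b∈xs
increasing⇒precedes (x< ∷ _) (there a∈xs) (here refl) a<b = contradiction (All.lookup x< a∈xs) (<-asym a<b)
increasing⇒precedes (_ ∷ inc) (there a∈xs) (there b∈xs) a<b = later (increasing⇒precedes inc a∈xs b∈xs a<b)

precedes⇒< : ∀ {a b xs} → Increasing xs → Precedes a b xs → a < b
precedes⇒< (a< ∷ _) (front b∈xs) = All.lookup a< b∈xs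
precedes⇒< (_ ∷ inc) (later p) = precedes⇒< inc p

∈f⇒precedes : ∀ {x y} xs → y ∈ f xs x → Precedes x y xs
∈f⇒precedes {x} (z ∷ zs) y∈ with z ≡ᵇ x | ≡ᵇ-reflects-≡ z x
... | true  | ofʸ refl = front y∈
... | false | _        = later (∈f⇒precedes zs y∈)

precedes⇒∈f : ∀ {x y xs} → Unique xs → Precedes x y xs → y ∈ f xs x
precedes⇒∈f {x} {xs = z ∷ zs} (z∉ ∷ u) p with z ≡ᵇ x | ≡ᵇ-reflects-≡ z x | p
... | true  | ofʸ refl | front y∈zs = y∈zs
... | true  | ofʸ refl | later q = contradiction refl (All.lookup z∉ (precedes⇒∈ˡ q))
... | false | ofⁿ z≢x | front _ = contradiction refl z≢x
... | false | ofⁿ _   | later q = precedes⇒∈f u q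

f⁺ : ∀ {R : ℕ → ℕ → Set} {x} xs → AllPairs R xs → AllPairs R (f xs x)
f⁺ [] _ = []
f⁺ {x = x} (z ∷ zs) (_ ∷ Rzs) with z ≡ᵇ x
... | true  = Rzs
... | false = f⁺ zs Rzs

f-++ : ∀ {x} (xs : List ℕ) ys → x ∉ xs → f (xs ++ x ∷ ys) x ≡ ys
f-++ {x} [] ys _ with x ≡ᵇ x | ≡ᵇ-reflects-≡ x x
... | true  | _       = refl
... | false | ofⁿ x≢x = contradiction refl x≢x
f-++ {x} (z ∷ zs) ys x∉ with z ≡ᵇ x | ≡ᵇ-reflects-≡ z x
... | true  | ofʸ refl = contradiction (here refl) x∉
... | false | _        = f-++ zs ys (x∉ ∘ there)

f-nth : ∀ {xs} k → Unique xs → k < length xs → f xs (nth xs k) ≡ drop (suc k) xs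
f-nth {xs} k u k<n = begin
  f xs (nth xs k)                                 ≡⟨ cong (λ ys → f ys (nth xs k)) (sym split) ⟩
  f (take k xs ++ nth xs k ∷ drop (suc k) xs) (nth xs k) ≡⟨ f-++ (take k xs) (drop (suc k) xs) nth∉take ⟩
  drop (suc k) xs                                 ∎
  where
  open ≡-Reasoning
  split : take k xs ++ nth xs k ∷ drop (suc k) xs ≡ xs
  split = trans (cong (take k xs ++_) (sym (drop-nth k xs k<n))) (take++drop≡id k xs)
  nth∉take : nth xs k ∉ take k xs
  nth∉take ∈take = unique-++-disjoint (take k xs) (subst Unique (sym split) u) ∈take (here refl)

-- step ψ (P , p) unfolds to the list below with n = length P.
∈-insert : ∀ n ψ {y p} → y ∈ ψ → y ≢ p → y ∈ take n ψ ++ p ∷ removeFirst p (drop n ψ)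
∈-insert zero ψ y∈ y≢p = there (∈-removeFirst⁺ ψ y∈ y≢p)
∈-insert (suc n) (x ∷ xs) (here refl) _ = here refl
∈-insert (suc n) (x ∷ xs) (there y∈) y≢p = there (∈-insert n xs y∈ y≢p)

precedes-removeFirst : ∀ {a b p} ys → Precedes a b ys → b ≢ p →
  Precedes a b (removeFirst p ys) ⊎ (a ≡ p × b ∈ removeFirst p ys)
precedes-removeFirst {p = p} (x ∷ xs) prec b≢p with x ≡ᵇ p | ≡ᵇ-reflects-≡ x p | prec
... | true  | ofʸ refl | front b∈ = inj₂ (refl , b∈)
... | true  | _        | later q = inj₁ q
... | false | _        | front b∈ = inj₁ (front (∈-removeFirst⁺ xs b∈ b≢p))
... | false | _        | later q with precedes-removeFirst xs q b≢p
...   | inj₁ q′ = inj₁ (later q′)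
...   | inj₂ (a≡p , b∈) = inj₂ (a≡p , there b∈)

precedes-insert : ∀ n ψ {a b p} → Precedes a b ψ → b ≢ p →
  Precedes a b (take n ψ ++ p ∷ removeFirst p (drop n ψ))
precedes-insert zero ψ prec b≢p with precedes-removeFirst ψ prec b≢p
... | inj₁ q = later q
... | inj₂ (refl , b∈) = front b∈
precedes-insert (suc n) (x ∷ xs) (front b∈) b≢p = front (∈-insert n xs b∈ b≢p)
precedes-insert (suc n) (x ∷ xs) (later q) b≢p = later (precedes-insert n xs q b≢p)

moved : List Call → List ℕ
moved = map proj₂

bucketMoved : List Call → List ℕ
bucketMoved [] = []
bucketMoved ((P , p) ∷ cs) with length P
... | zero  = bucketMoved cs
... | suc _ = p ∷ bucketMoved cs

bucketed≡length-bucketMoved : ∀ cs → bucketed cs ≡ length (bucketMoved cs)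
bucketed≡length-bucketMoved [] = refl
bucketed≡length-bucketMoved ((P , p) ∷ cs) with length P
... | zero  = bucketed≡length-bucketMoved cs
... | suc _ = cong suc (bucketed≡length-bucketMoved cs)

bucketed-nonbucketed : ∀ ys → bucketed (map ([] ,_) ys) ≡ 0
bucketed-nonbucketed [] = refl
bucketed-nonbucketed (y ∷ ys) = bucketed-nonbucketed ys

bucketed-bucketed : ∀ {P} ys → 0 < length P → bucketed (map (P ,_) ys) ≡ length ys
bucketed-bucketed {[]} _ ()
bucketed-bucketed {_ ∷ _} [] _ = refl
bucketed-bucketed {_ ∷ _} (y ∷ ys) _ = cong suc (bucketed-bucketed ys (s≤s z≤n))

bucketed-++ : ∀ cs ds → bucketed (cs ++ ds) ≡ bucketed cs + bucketed ds
bucketed-++ [] ds = refl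
bucketed-++ ((P , p) ∷ cs) ds with length P
... | zero  = bucketed-++ cs ds
... | suc _ = cong suc (bucketed-++ cs ds)

run-++ : ∀ ψ cs ds → run ψ (cs ++ ds) ≡ run (run ψ cs) ds
run-++ ψ [] ds = refl
run-++ ψ (c ∷ cs) ds = run-++ (step ψ c) cs ds

legalSeq-++ : ∀ ψ cs ds → LegalSeq ψ cs → LegalSeq (run ψ cs) ds → LegalSeq ψ (cs ++ ds)
legalSeq-++ ψ [] ds _ legal = legal
legalSeq-++ ψ (c ∷ cs) ds (legal , legals) legal′ = legal , legalSeq-++ (step ψ c) cs ds legals legal′

precedes-run : ∀ cs ψ {a b} → b ∉ moved cs → Precedes a b ψ → Precedes a b (run ψ cs)
precedes-run [] ψ _ prec = prec
precedes-run ((P , p) ∷ cs) ψ b∉ prec =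
  precedes-run cs _ (b∉ ∘ there) (precedes-insert (length P) ψ prec (b∉ ∘ here))

bucketMoved-there : ∀ P p cs {x} → x ∈ bucketMoved cs → x ∈ bucketMoved ((P , p) ∷ cs)
bucketMoved-there P p cs x∈ with length P
... | zero  = x∈
... | suc _ = there x∈

bucketMoved-head : ∀ P p cs → length P ≢ 0 → p ∈ bucketMoved ((P , p) ∷ cs)
bucketMoved-head P p cs P≢[] with length P
... | zero  = contradiction refl P≢[]
... | suc _ = here refl

step-nonbucketed : ∀ ψ {P p} → length P ≡ 0 → step ψ (P , p) ≡ p ∷ removeFirst p ψ
step-nonbucketed ψ P≡[] rewrite P≡[] = refl

lastMove-bucketed : ∀ cs ψ {a x} → a ∉ moved cs → a ∈ ψ → x ∈ moved cs →
  Unique (run ψ cs) → Precedes a x (run ψ cs) → x ∈ bucketMoved cs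
lastMove-bucketed ((P , p) ∷ cs) ψ {a} {x} a∉ a∈ψ x∈ u a≺x with x ∈? moved cs
... | yes x∈cs = bucketMoved-there P p cs
  (lastMove-bucketed cs (step ψ (P , p)) (a∉ ∘ there) (∈-insert (length P) ψ a∈ψ (a∉ ∘ here)) x∈cs u a≺x)
... | no x∉cs with x∈
...   | there x∈cs = contradiction x∈cs x∉cs
...   | here refl with length P ≟ 0
...     | no P≢[] = bucketMoved-head P x cs P≢[]
...     | yes P≡[] = contradiction x≺a (precedes-asym u a≺x)
  where
  x≺a : Precedes x a (run ψ ((P , x) ∷ cs))
  x≺a = precedes-run cs (step ψ (P , x)) (a∉ ∘ there)
          (subst (Precedes x a) (sym (step-nonbucketed ψ {P} P≡[])) (front (∈-removeFirst⁺ ψ a∈ψ (a∉ ∘ here))))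

-- Moving modes to the front of an increasing tail

record Enumerates (P : ℕ → Set) (T : List ℕ) : Set where
  field
    increasing : Increasing T
    members    : ∀ {z} → z ∈ T ⇔ P z

  ∈⇒P : ∀ {z} → z ∈ T → P z
  ∈⇒P = Equivalence.to members

  P⇒∈ : ∀ {z} → P z → z ∈ T
  P⇒∈ = Equivalence.from members

enumerates-cong : ∀ {P Q T} → (∀ {z} → P z ⇔ Q z) → Enumerates P T → Enumerates Q T
enumerates-cong P⇔Q e = record
  { increasing = increasing
  ; members = mk⇔ (Equivalence.to P⇔Q ∘ ∈⇒P) (P⇒∈ ∘ Equivalence.from P⇔Q)
  }
  where open Enumerates e

enumerates-[] : ∀ {T} → Enumerates (_∈ []) T → T ≡ []
enumerates-[] {[]} _ = refl
enumerates-[] {t ∷ _} e with Enumerates.∈⇒P e (here refl)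
... | ()

enumerates-minimum : ∀ {x zs T} → Enumerates (_∈ x ∷ zs) T → All (x <_) zs →
  Σ[ T′ ∈ List ℕ ] T ≡ x ∷ T′ × Enumerates (_∈ zs) T′
enumerates-minimum {T = []} e _ with Enumerates.P⇒∈ e (here refl)
... | ()
enumerates-minimum {x} {zs} {t ∷ T′} e x<zs
  with Enumerates.P⇒∈ e (here refl) | Enumerates.∈⇒P e (here refl) | Enumerates.increasing e
... | here refl | _ | _ ∷ inc′ = T′ , refl , record { increasing = inc′ ; members = mk⇔ to from }
  where
  to : ∀ {z} → z ∈ T′ → z ∈ zs
  to {z} z∈T′ with Enumerates.∈⇒P e (there z∈T′) | Enumerates.increasing e
  ... | here refl   | x< ∷ _ = contradiction (All.lookup x< z∈T′) (<-irrefl refl)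
  ... | there z∈zs  | _ = z∈zs
  from : ∀ {z} → z ∈ zs → z ∈ T′
  from {z} z∈zs with Enumerates.P⇒∈ e (there z∈zs)
  ... | here refl   = contradiction (All.lookup x<zs z∈zs) (<-irrefl refl)
  ... | there z∈T′  = z∈T′
... | there x∈T′ | here refl  | t< ∷ _ = contradiction (All.lookup t< x∈T′) (<-irrefl refl)
... | there x∈T′ | there t∈zs | t< ∷ _ = contradiction (All.lookup x<zs t∈zs) (<-asym (All.lookup t< x∈T′))

removeFirst-enumerates : ∀ {P T p} → Enumerates P T → Enumerates (λ z → P z × z ≢ p) (removeFirst p T)
removeFirst-enumerates {T = T} e = record
  { increasing = removeFirst⁺ increasing
  ; members = mk⇔ (λ z∈ → ∈⇒P (∈-removeFirst⁻ T z∈) , ∈-removeFirst-≢ (increasing⇒unique increasing) z∈)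
                  (λ (Pz , z≢p) → ∈-removeFirst⁺ T (P⇒∈ Pz) z≢p)
  }
  where open Enumerates e

legal-after-prefix : ∀ Pfx D T {p} → p ∈ T → Legal (Pfx ++ D ++ T) (Pfx , p)
legal-after-prefix Pfx D T p∈T =
  take-length-++ Pfx (D ++ T) , subst (_ ∈_) (sym (drop-length-++ Pfx (D ++ T))) (∈-++⁺ʳ D p∈T)

step-after-prefix : ∀ Pfx D T {p} → p ∉ D → step (Pfx ++ D ++ T) (Pfx , p) ≡ Pfx ++ p ∷ D ++ removeFirst p T
step-after-prefix Pfx D T p∉D
  rewrite take-length-++ Pfx (D ++ T) | drop-length-++ Pfx (D ++ T) | removeFirst-++ D T p∉D = refl

moves-to-front : ∀ Pfx D {P T} ys → Unique ys → Enumerates P T → All P ys → All (_∉ D) ys →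
  LegalSeq (Pfx ++ D ++ T) (map (Pfx ,_) ys)
  × Σ[ T′ ∈ List ℕ ] run (Pfx ++ D ++ T) (map (Pfx ,_) ys) ≡ Pfx ++ reverse ys ++ D ++ T′
                     × Enumerates (λ z → P z × z ∉ ys) T′
moves-to-front Pfx D {T = T} [] _ e _ _ =
  tt , T , refl , enumerates-cong (mk⇔ (_, λ ()) proj₁) e
moves-to-front Pfx D {P} {T} (y ∷ ys) (y∉ys ∷ u) e (Py ∷ Pys) (y∉D ∷ ys∉D)
  with moves-to-front Pfx (y ∷ D) ys u (removeFirst-enumerates e)
         (All.zipWith (λ (Pz , y≢z) → Pz , y≢z ∘ sym) (Pys , y∉ys))
         (All.zipWith (λ (y≢z , z∉D) → λ { (here z≡y) → y≢z (sym z≡y) ; (there z∈D) → z∉D z∈D }) (y∉ys , ys∉D))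
... | legal , T′ , run≡ , e′ =
  (legal-after-prefix Pfx D T (Enumerates.P⇒∈ e Py) , subst (λ ψ → LegalSeq ψ cs) (sym step≡) legal) ,
  T′ , trans (cong (λ ψ → run ψ cs) step≡) (trans run≡ reassoc) ,
  enumerates-cong (mk⇔ (λ ((Pz , z≢y) , z∉ys) → Pz , λ { (here z≡y) → z≢y z≡y ; (there z∈ys) → z∉ys z∈ys })
                       (λ (Pz , z∉yys) → (Pz , z∉yys ∘ here) , z∉yys ∘ there)) e′
  where
  cs = map (Pfx ,_) ys
  step≡ : step (Pfx ++ D ++ T) (Pfx , y) ≡ Pfx ++ (y ∷ D) ++ removeFirst y T
  step≡ = step-after-prefix Pfx D T y∉D
  reassoc : Pfx ++ reverse ys ++ (y ∷ D) ++ T′ ≡ Pfx ++ reverse (y ∷ ys) ++ D ++ T′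
  reassoc = cong (Pfx ++_) (trans (sym (++-assoc (reverse ys) [ y ] (D ++ T′)))
                                  (cong (_++ D ++ T′) (sym (unfold-reverse y ys))))

module _ (r : ℕ) (σ : List ℕ) where
  open Quesadilla r σ

  emit-[] : ∀ l → emit l l ≡ []
  emit-[] zero = refl
  emit-[] (suc l) with l <ᵇ l | <ᵇ-reflects-< l l
  ... | true  | ofʸ l<l = contradiction l<l (<-irrefl refl)
  ... | false | _       = refl

  emit-∷ : ∀ {l k} → l ≤ k → emit l (suc k) ≡ (take l σ , nth σ k) ∷ emit l k
  emit-∷ {l} {k} l≤k with l <ᵇ suc k | <ᵇ-reflects-< l (suc k)
  ... | true  | _       = refl
  ... | false | ofⁿ l≮ = contradiction (s≤s l≤k) l≮

  emit-block : ∀ l m → l + m ≤ length σ → emit l (l + m) ≡ map (take l σ ,_) (reverse (take m (drop l σ)))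
  emit-block l zero _ rewrite +-identityʳ l = emit-[] l
  emit-block l (suc m) l+m<n rewrite +-suc l m = begin
    emit l (suc (l + m))
      ≡⟨ emit-∷ (m≤m+n l m) ⟩
    (take l σ , nth σ (l + m)) ∷ emit l (l + m)
      ≡⟨ cong₂ (λ y cs → (take l σ , y) ∷ cs) (sym (nth-drop l m σ)) (emit-block l m (<⇒≤ l+m<n)) ⟩
    map (take l σ ,_) (nth σₗ m ∷ reverse (take m σₗ))
      ≡⟨ cong (map (take l σ ,_)) (sym (reverse-++ (take m σₗ) [ nth σₗ m ])) ⟩
    map (take l σ ,_) (reverse (take m σₗ ++ [ nth σₗ m ]))
      ≡⟨ cong (map (take l σ ,_) ∘ reverse) (sym (take-suc-nth m σₗ (<-length-drop l m σ l+m<n))) ⟩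
    map (take l σ ,_) (reverse (take (suc m) σₗ)) ∎
    where
    open ≡-Reasoning
    σₗ = drop l σ

  loop-done : ∀ fuel → loop fuel r ≡ []
  loop-done zero = refl
  loop-done (suc fuel) with r <ᵇ r | <ᵇ-reflects-< r r
  ... | true  | ofʸ r<r = contradiction r<r (<-irrefl refl)
  ... | false | _       = refl

  loop-unfold : ∀ {fuel l} → l < r → loop (suc fuel) l ≡ emit l (scan r l) ++ loop fuel (suc (scan r l))
  loop-unfold {l = l} l<r with l <ᵇ r | <ᵇ-reflects-< l r
  ... | true  | _       = refl
  ... | false | ofⁿ l≮r = contradiction l<r l≮r

-- Needy modes and the two lower bounds

module _ {r : ℕ} {σ : List ℕ} (σ↭S : σ ↭ simple r) where

  private
    S : List ℕ
    S = simple r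

  σ-unique : Unique σ
  σ-unique = unique-resp-↭ (↭-sym σ↭S) (increasing⇒unique (simple-increasing r))

  ∈σ⇒∈S : ∀ {x} → x ∈ σ → x ∈ S
  ∈σ⇒∈S = ∈-resp-↭ σ↭S

  ∈S⇒∈σ : ∀ {x} → x ∈ S → x ∈ σ
  ∈S⇒∈σ = ∈-resp-↭ (↭-sym σ↭S)

  length-σ : length σ ≡ r
  length-σ = trans (↭-length σ↭S) (length-simple r)

  <r⇒<length-σ : ∀ {k} → k < r → k < length σ
  <r⇒<length-σ {k} = subst (k <_) (sym length-σ)

  σ-positive : ∀ {x} → x ∈ σ → 0 < x
  σ-positive x∈σ = All.lookup (simple-positive r) (∈σ⇒∈S x∈σ)

  -- The modes that every transforming sequence has to move.
  Needy : ℕ → Set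
  Needy x = Any (_< x) (f σ x)

  needy? : ∀ x → Dec (Needy x)
  needy? x = any? (_<? x) (f σ x)

  needyCount : List ℕ → ℕ
  needyCount xs = length (filter needy? xs)

  ¬needy⇒later-larger : ∀ {x} → ¬ Needy x → All (x <_) (f σ x)
  ¬needy⇒later-larger {x} ¬n = All.tabulate later-larger
    where
    later-larger : ∀ {y} → y ∈ f σ x → x < y
    later-larger {y} y∈ with <-cmp x y
    ... | tri< x<y _ _ = x<y
    ... | tri≈ _ refl _ = contradiction (∈f⇒precedes σ y∈) (λ p → precedes-asym σ-unique p p)
    ... | tri> _ _ y<x = contradiction (lose y∈ y<x) ¬n

  ¬needy-1 : ¬ Needy 1
  ¬needy-1 n with find n
  ... | _ , 0∈ , s≤s z≤n =
    <-irrefl refl (σ-positive (precedes⇒∈ʳ (∈f⇒precedes σ 0∈)))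

  needy⇒moved : ∀ {cs x} → Transforms r σ cs → Needy x → x ∈ moved cs
  needy⇒moved {cs} {x} (_ , run≡σ) n with find n | x ∈? moved cs
  ... | _ | yes x∈ = x∈
  ... | y , y∈ , y<x | no x∉ = contradiction (∈f⇒precedes σ y∈) (precedes-asym σ-unique y≺x)
    where
    y≺x : Precedes y x σ
    y≺x = subst (Precedes y x) run≡σ (precedes-run cs S x∉
            (increasing⇒precedes (simple-increasing r) (∈σ⇒∈S (precedes⇒∈ʳ (∈f⇒precedes σ y∈)))
              (∈σ⇒∈S (precedes⇒∈ˡ (∈f⇒precedes σ y∈))) y<x))

  ∈-filter-needy⁻ : ∀ xs {x} → x ∈ filter needy? xs → x ∈ xs × Needy x
  ∈-filter-needy⁻ xs = ∈-filter⁻ needy? {xs = xs}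

  filter-needy⊆moved : ∀ {cs} → Transforms r σ cs → ∀ {x} → x ∈ filter needy? σ → x ∈ moved cs
  filter-needy⊆moved t x∈ = needy⇒moved t (proj₂ (∈-filter-needy⁻ σ x∈))

  length-lower-bound : ∀ {cs} → Transforms r σ cs → needyCount σ ≤ length cs
  length-lower-bound {cs} t =
    subst (_ ≤_) (length-map proj₂ cs)
      (unique-⊆⇒length≤ (moved cs) (Uniqueₚ.filter⁺ needy? σ-unique) (filter-needy⊆moved t))

  shortest⇒1-unmoved : ∀ {cs} → Transforms r σ cs → length cs ≡ needyCount σ → 1 ∉ moved cs
  shortest⇒1-unmoved {cs} t shortest 1∈ =
    <-irrefl refl (subst (λ n → suc n ≤ length cs) (sym shortest)
      (subst (_ ≤_) (length-map proj₂ cs) (unique-⊆⇒length≤ (moved cs) 1∷needy-unique 1∷needy⊆moved)))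
    where
    1∷needy-unique : Unique (1 ∷ filter needy? σ)
    1∷needy-unique = All.tabulate (λ x∈ 1≡x → ¬needy-1 (subst Needy (sym 1≡x) (proj₂ (∈-filter-needy⁻ σ x∈))))
                     ∷ Uniqueₚ.filter⁺ needy? σ-unique
    1∷needy⊆moved : ∀ {x} → x ∈ 1 ∷ filter needy? σ → x ∈ moved cs
    1∷needy⊆moved (here refl) = 1∈
    1∷needy⊆moved (there x∈) = filter-needy⊆moved t x∈

  shortest⇒bucketed-lower-bound : ∀ {cs} → Transforms r σ cs → length cs ≡ needyCount σ →
    needyCount (f σ 1) ≤ bucketed cs
  shortest⇒bucketed-lower-bound {cs} t@(_ , run≡σ) shortest =
    subst (_ ≤_) (sym (bucketed≡length-bucketMoved cs))
      (unique-⊆⇒length≤ (bucketMoved cs) (Uniqueₚ.filter⁺ needy? (f⁺ σ σ-unique)) bucket-moved)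
    where
    bucket-moved : ∀ {x} → x ∈ filter needy? (f σ 1) → x ∈ bucketMoved cs
    bucket-moved x∈ with ∈-filter-needy⁻ (f σ 1) x∈
    ... | x∈f , n =
      lastMove-bucketed cs S (shortest⇒1-unmoved t shortest) (∈σ⇒∈S (precedes⇒∈ˡ (∈f⇒precedes σ x∈f)))
        (needy⇒moved t n) (subst Unique (sym run≡σ) σ-unique) (subst (Precedes 1 _) (sym run≡σ) (∈f⇒precedes σ x∈f))

  -- QuesadillaSort attains both bounds

  open Quesadilla r σ

  cond≡needy? : ∀ k → cond k ≡ does (needy? (nth σ k))
  cond≡needy? k = test≡needy? (nth σ k)
    where
    test≡needy? : ∀ x → not (subsetᵇ (f σ x) (f S x)) ≡ does (needy? x)
    test≡needy? x with needy? x
    ... | yes n = det (¬-reflects (subsetᵇ-reflects _ _)) (ofʸ (λ ⊆ → All.lookupWith later-not-in-S ⊆ n))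
      where
      later-not-in-S : ∀ {y} → y ∈ f S x → y < x → ⊥
      later-not-in-S y∈ y<x = <-asym y<x (precedes⇒< (simple-increasing r) (∈f⇒precedes S y∈))
    ... | no ¬n = det (¬-reflects (subsetᵇ-reflects _ _)) (ofⁿ (λ ¬⊆ → ¬⊆ (All.tabulate later-in-S)))
      where
      later-in-S : ∀ {y} → y ∈ f σ x → y ∈ f S x
      later-in-S y∈ =
        precedes⇒∈f (increasing⇒unique (simple-increasing r))
          (increasing⇒precedes (simple-increasing r) (∈σ⇒∈S (precedes⇒∈ˡ (∈f⇒precedes σ y∈)))
            (∈σ⇒∈S (precedes⇒∈ʳ (∈f⇒precedes σ y∈))) (All.lookup (¬needy⇒later-larger ¬n) y∈))

  scan-continue : ∀ {fuel k} → suc k < r → Needy (nth σ k) → scan (suc fuel) k ≡ scan fuel (suc k)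
  scan-continue {fuel} {k} sk<r n with suc k <ᵇ r | <ᵇ-reflects-< (suc k) r
  ... | false | ofⁿ sk≮r = contradiction sk<r sk≮r
  ... | true  | _ rewrite cond≡needy? k with needy? (nth σ k)
  ...   | yes _ = refl
  ...   | no ¬n = contradiction n ¬n

  scan-stop : ∀ {fuel k} → ¬ Needy (nth σ k) → scan (suc fuel) k ≡ k
  scan-stop {fuel} {k} ¬n with suc k <ᵇ r
  ... | false = refl
  ... | true rewrite cond≡needy? k with needy? (nth σ k)
  ...   | yes n = contradiction n ¬n
  ...   | no _  = refl

  ¬needy-last : ∀ {k} → suc k ≡ r → ¬ Needy (nth σ k)
  ¬needy-last {k} sk≡r n with subst (Any (_< nth σ k)) no-later n
    where
    no-later : f σ (nth σ k) ≡ []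
    no-later = trans (f-nth k σ-unique (≤-reflexive (trans sk≡r (sym length-σ))))
                     (drop-all (suc k) σ (≤-reflexive (trans length-σ (sym sk≡r))))
  ... | ()

  -- The positions (0-based) handled by one pass of the outer loop of QuesadillaSort.
  record Block (l m : ℕ) : Set where
    field
      bounded : l + m < r
      needy   : All Needy (take m (drop l σ))
      closing : ¬ Needy (nth σ (l + m))

  scan-block : ∀ {l} → l < r → Σ[ m ∈ ℕ ] scan r l ≡ l + m × Block l m
  scan-block {l} l<r = subst (λ k → Σ[ m ∈ ℕ ] scan r k ≡ l + m × Block l m) (+-identityʳ l)
                         (extend r 0 (subst (_< r) (sym (+-identityʳ l)) l<r) fuel-ok [])
    where
    fuel-ok : r ≤ r + (l + 0)
    fuel-ok = ≤-trans (m≤m+n r l) (≤-reflexive (cong (r +_) (sym (+-identityʳ l))))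
    grow : ∀ m → l + m < r → All Needy (take m (drop l σ)) → Needy (nth σ (l + m)) →
           All Needy (take (suc m) (drop l σ))
    grow m l+m<r needy n =
      subst (All Needy) (sym (take-suc-nth m (drop l σ) (<-length-drop l m σ (<r⇒<length-σ l+m<r))))
        (Allₚ.++⁺ needy (subst Needy (sym (nth-drop l m σ)) n ∷ []))
    extend : ∀ fuel m → l + m < r → r ≤ fuel + (l + m) → All Needy (take m (drop l σ)) →
             Σ[ m′ ∈ ℕ ] scan fuel (l + m) ≡ l + m′ × Block l m′
    extend zero m l+m<r fuel-ok _ = contradiction (<-≤-trans l+m<r fuel-ok) (<-irrefl refl)
    extend (suc fuel) m l+m<r fuel-ok needy with needy? (nth σ (l + m))
    ... | no ¬n = m , scan-stop {fuel} ¬n , record { bounded = l+m<r ; needy = needy ; closing = ¬n }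
    ... | yes n with suc (l + m) <? r
    ...   | no l+m+1≮r = contradiction n (¬needy-last (≤-antisym l+m<r (≮⇒≥ l+m+1≮r)))
    ...   | yes l+m+1<r
      with extend fuel (suc m) (subst (_< r) (sym (+-suc l m)) l+m+1<r)
             (subst (r ≤_) (sym (trans (cong (fuel +_) (+-suc l m)) (+-suc fuel (l + m)))) fuel-ok)
             (grow m l+m<r needy n)
    ...     | m′ , scan≡ , block =
      m′ , trans (scan-continue {fuel} l+m+1<r n) (trans (cong (scan fuel) (sym (+-suc l m))) scan≡) , block

  -- Invariant of the outer loop.
  SortedAfter : ℕ → List ℕ → Set
  SortedAfter l ψ = Σ[ T ∈ List ℕ ] ψ ≡ take l σ ++ T × Enumerates (_∈ drop l σ) T

  module _ {l m : ℕ} (block : Block l m) where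
    open Block block

    private
      l+m<|σ| : l + m < length σ
      l+m<|σ| = <r⇒<length-σ bounded

    block-split : drop l σ ≡ take m (drop l σ) ++ nth σ (l + m) ∷ drop (suc (l + m)) σ
    block-split = begin
      drop l σ                                ≡⟨ sym (take++drop≡id m (drop l σ)) ⟩
      take m (drop l σ) ++ drop m (drop l σ)  ≡⟨ cong (take m (drop l σ) ++_) (drop-drop l m σ) ⟩
      take m (drop l σ) ++ drop (l + m) σ     ≡⟨ cong (take m (drop l σ) ++_) (drop-nth (l + m) σ l+m<|σ|) ⟩
      take m (drop l σ) ++ nth σ (l + m) ∷ drop (suc (l + m)) σ ∎
      where open ≡-Reasoning

    block-take : take (suc (l + m)) σ ≡ take l σ ++ take m (drop l σ) ++ [ nth σ (l + m) ]
    block-take = begin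
      take (suc (l + m)) σ                                ≡⟨ take-suc-nth (l + m) σ l+m<|σ| ⟩
      take (l + m) σ ++ [ nth σ (l + m) ]                 ≡⟨ cong (_++ [ nth σ (l + m) ]) (take-+ l m σ) ⟩
      (take l σ ++ take m (drop l σ)) ++ [ nth σ (l + m) ] ≡⟨ ++-assoc (take l σ) _ _ ⟩
      take l σ ++ take m (drop l σ) ++ [ nth σ (l + m) ]   ∎
      where open ≡-Reasoning

    length-block : length (take m (drop l σ)) ≡ m
    length-block = trans (length-take m (drop l σ)) (m≤n⇒m⊓n≡m (<⇒≤ (<-length-drop l m σ l+m<|σ|)))

    length-take-l : length (take l σ) ≡ l
    length-take-l = trans (length-take l σ) (m≤n⇒m⊓n≡m (≤-trans (m≤m+n l m) (<⇒≤ l+m<|σ|)))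

    needyCount-block : needyCount (drop l σ) ≡ m + needyCount (drop (suc (l + m)) σ)
    needyCount-block = begin
      needyCount (drop l σ)
        ≡⟨ cong (length ∘ filter needy?) block-split ⟩
      length (filter needy? (take m (drop l σ) ++ nth σ (l + m) ∷ drop (suc (l + m)) σ))
        ≡⟨ cong length (filter-++ needy? (take m (drop l σ)) (nth σ (l + m) ∷ drop (suc (l + m)) σ)) ⟩
      length (filter needy? (take m (drop l σ)) ++ filter needy? (nth σ (l + m) ∷ drop (suc (l + m)) σ))
        ≡⟨ cong₂ (λ xs ys → length (xs ++ ys)) (filter-all needy? needy) (filter-reject needy? closing) ⟩
      length (take m (drop l σ) ++ filter needy? (drop (suc (l + m)) σ))
        ≡⟨ trans (length-++ (take m (drop l σ))) (cong (_+ needyCount (drop (suc (l + m)) σ)) length-block) ⟩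
      m + needyCount (drop (suc (l + m)) σ) ∎
      where open ≡-Reasoning

    length-emit : length (emit l (l + m)) ≡ m
    length-emit = begin
      length (emit l (l + m))                                  ≡⟨ cong length (emit-block r σ l m (<⇒≤ l+m<|σ|)) ⟩
      length (map (take l σ ,_) (reverse (take m (drop l σ)))) ≡⟨ length-map _ (reverse (take m (drop l σ))) ⟩
      length (reverse (take m (drop l σ)))                     ≡⟨ length-reverse (take m (drop l σ)) ⟩
      length (take m (drop l σ))                               ≡⟨ length-block ⟩
      m                                                        ∎
      where open ≡-Reasoning

    bucketed-emit : 0 < l → bucketed (emit l (l + m)) ≡ m
    bucketed-emit 0<l = begin
      bucketed (emit l (l + m))
        ≡⟨ cong bucketed (emit-block r σ l m (<⇒≤ l+m<|σ|)) ⟩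
      bucketed (map (take l σ ,_) (reverse (take m (drop l σ))))
        ≡⟨ bucketed-bucketed (reverse (take m (drop l σ))) (subst (0 <_) (sym length-take-l) 0<l) ⟩
      length (reverse (take m (drop l σ)))
        ≡⟨ length-reverse (take m (drop l σ)) ⟩
      length (take m (drop l σ))
        ≡⟨ length-block ⟩
      m ∎
      where open ≡-Reasoning

    private
      Em : List ℕ
      Em = take m (drop l σ)
      x : ℕ
      x = nth σ (l + m)
      zs : List ℕ
      zs = drop (suc (l + m)) σ

      Em-unique : Unique (Em ++ x ∷ zs)
      Em-unique = subst Unique block-split (Uniqueₚ.drop⁺ l σ-unique)

      remaining : ∀ {z} → (z ∈ drop l σ × z ∉ reverse Em) ⇔ z ∈ x ∷ zs
      remaining = mk⇔ to from
        where
        to : ∀ {z} → z ∈ drop l σ × z ∉ reverse Em → z ∈ x ∷ zs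
        to (z∈ , z∉) with ∈-++⁻ Em (subst (_ ∈_) block-split z∈)
        ... | inj₁ z∈Em = contradiction (reverse⁺ z∈Em) z∉
        ... | inj₂ z∈xzs = z∈xzs
        from : ∀ {z} → z ∈ x ∷ zs → z ∈ drop l σ × z ∉ reverse Em
        from z∈xzs = subst (_ ∈_) (sym block-split) (∈-++⁺ʳ Em z∈xzs) ,
                     λ z∈ → unique-++-disjoint Em Em-unique (reverse⁻ z∈) z∈xzs

    closing-minimal : All (nth σ (l + m) <_) (drop (suc (l + m)) σ)
    closing-minimal =
      subst (All (nth σ (l + m) <_)) (f-nth (l + m) σ-unique l+m<|σ|) (¬needy⇒later-larger closing)

    block-sorts : ∀ {ψ} → SortedAfter l ψ →
      LegalSeq ψ (emit l (l + m)) × SortedAfter (suc (l + m)) (run ψ (emit l (l + m)))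
    block-sorts (T , refl , e) rewrite emit-block r σ l m (<⇒≤ l+m<|σ|)
      with moves-to-front (take l σ) [] (reverse Em)
             (unique-resp-↭ (↭-sym (↭-reverse Em)) (Uniqueₚ.take⁺ m (Uniqueₚ.drop⁺ l σ-unique))) e
             (All.tabulate λ z∈ → subst (_ ∈_) (sym block-split) (∈-++⁺ˡ (reverse⁻ {xs = Em} z∈)))
             (All.tabulate λ _ ())
    ... | legal , T′ , run≡ , e′ with enumerates-minimum (enumerates-cong remaining e′) closing-minimal
    ... | T″ , refl , e″ = legal , T″ , trans run≡ shape , e″
      where
      open ≡-Reasoning
      shape : take l σ ++ reverse (reverse Em) ++ x ∷ T″ ≡ take (suc (l + m)) σ ++ T″
      shape = begin
        take l σ ++ reverse (reverse Em) ++ x ∷ T″ ≡⟨ cong (λ ys → take l σ ++ ys ++ x ∷ T″) (reverse-involutive Em) ⟩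
        take l σ ++ Em ++ [ x ] ++ T″              ≡⟨ cong (take l σ ++_) (sym (++-assoc Em [ x ] T″)) ⟩
        take l σ ++ (Em ++ [ x ]) ++ T″            ≡⟨ sym (++-assoc (take l σ) (Em ++ [ x ]) T″) ⟩
        (take l σ ++ Em ++ [ x ]) ++ T″            ≡⟨ cong (_++ T″) (sym block-take) ⟩
        take (suc (l + m)) σ ++ T″                 ∎

  LoopStep : (ℕ → List Call → Set) → Set
  LoopStep P = ∀ {l m} fuel → Block l m → P (suc (l + m)) (loop fuel (suc (l + m))) →
                                         P l (emit l (l + m) ++ loop fuel (suc (l + m)))

  -- Induction along the outer loop; r ≤ fuel + l says the fuel suffices to reach r.
  loop-elim : (P : ℕ → List Call → Set) → P r [] → LoopStep P →
    ∀ fuel l → l ≤ r → r ≤ fuel + l → P l (loop fuel l)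
  loop-elim P done next fuel l l≤r enough with m≤n⇒m<n∨m≡n l≤r
  ... | inj₂ refl = subst (P r) (sym (loop-done r σ fuel)) done
  loop-elim P done next zero l l≤r enough | inj₁ l<r = contradiction (<-≤-trans l<r enough) (<-irrefl refl)
  loop-elim P done next (suc fuel) l l≤r enough | inj₁ l<r with scan-block l<r
  ... | m , scan≡ , block =
    subst (P l) (sym (trans (loop-unfold r σ {fuel} l<r) (cong (λ k → emit l k ++ loop fuel (suc k)) scan≡)))
      (next fuel block (loop-elim P done next fuel (suc (l + m)) (Block.bounded block) enough′))
    where
    enough′ : r ≤ fuel + suc (l + m)
    enough′ = ≤-trans enough (≤-trans (s≤s (+-monoʳ-≤ fuel (m≤m+n l m))) (≤-reflexive (sym (+-suc fuel (l + m)))))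

  private
    drop-r : drop r σ ≡ []
    drop-r = drop-all r σ (≤-reflexive length-σ)

  loop-length : ∀ fuel l → l ≤ r → r ≤ fuel + l → length (loop fuel l) ≡ needyCount (drop l σ)
  loop-length = loop-elim (λ l cs → length cs ≡ needyCount (drop l σ)) (sym (cong needyCount drop-r)) next
    where
    next : LoopStep (λ l cs → length cs ≡ needyCount (drop l σ))
    next {l} {m} fuel block IH = begin
      length (emit l (l + m) ++ loop fuel (suc (l + m)))         ≡⟨ length-++ (emit l (l + m)) ⟩
      length (emit l (l + m)) + length (loop fuel (suc (l + m))) ≡⟨ cong₂ _+_ (length-emit block) IH ⟩
      m + needyCount (drop (suc (l + m)) σ)                     ≡⟨ sym (needyCount-block block) ⟩
      needyCount (drop l σ)                                     ∎
      where open ≡-Reasoning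

  loop-bucketed : ∀ fuel l → l ≤ r → r ≤ fuel + l → 0 < l → bucketed (loop fuel l) ≡ needyCount (drop l σ)
  loop-bucketed =
    loop-elim (λ l cs → 0 < l → bucketed cs ≡ needyCount (drop l σ)) (λ _ → sym (cong needyCount drop-r)) next
    where
    next : LoopStep (λ l cs → 0 < l → bucketed cs ≡ needyCount (drop l σ))
    next {l} {m} fuel block IH 0<l = begin
      bucketed (emit l (l + m) ++ loop fuel (suc (l + m)))
        ≡⟨ bucketed-++ (emit l (l + m)) _ ⟩
      bucketed (emit l (l + m)) + bucketed (loop fuel (suc (l + m)))
        ≡⟨ cong₂ _+_ (bucketed-emit block 0<l) (IH (s≤s z≤n)) ⟩
      m + needyCount (drop (suc (l + m)) σ)
        ≡⟨ sym (needyCount-block block) ⟩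
      needyCount (drop l σ) ∎
      where open ≡-Reasoning

  SortsFrom : ℕ → List Call → Set
  SortsFrom l cs = ∀ {ψ} → SortedAfter l ψ → LegalSeq ψ cs × run ψ cs ≡ σ

  loop-sorts : ∀ fuel l → l ≤ r → r ≤ fuel + l → SortsFrom l (loop fuel l)
  loop-sorts = loop-elim SortsFrom done next
    where
    done : SortsFrom r []
    done (T , refl , e) = tt , trans (cong₂ _++_ (take-all r σ (≤-reflexive length-σ))
                                                (enumerates-[] (subst (λ xs → Enumerates (_∈ xs) T) drop-r e)))
                                    (++-identityʳ σ)
    next : LoopStep SortsFrom
    next {l} {m} fuel block IH {ψ} sorted with block-sorts block sorted
    ... | legal , sorted′ with IH sorted′
    ...   | legal′ , run≡σ =
      legalSeq-++ ψ (emit l (l + m)) _ legal legal′ , trans (run-++ ψ (emit l (l + m)) _) run≡σ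

  private
    enough : r ≤ suc r + 0
    enough = ≤-trans (n≤1+n r) (≤-reflexive (sym (+-identityʳ (suc r))))

  quesadilla-transforms : Transforms r σ (quesadillaCalls r σ)
  quesadilla-transforms = loop-sorts (suc r) 0 z≤n enough
    (S , refl , record { increasing = simple-increasing r ; members = mk⇔ ∈S⇒∈σ ∈σ⇒∈S })

  quesadilla-length : length (quesadillaCalls r σ) ≡ needyCount σ
  quesadilla-length = loop-length (suc r) 0 z≤n enough

  first-block-closes-at-1 : ∀ {m} → Block 0 m → nth σ m ≡ 1
  first-block-closes-at-1 {m} block
    with ∈-++⁻ (take m σ) (subst (1 ∈_) (block-split block) (∈S⇒∈σ (1∈simple (≤-<-trans z≤n bounded))))
    where open Block block
  ... | inj₁ 1∈Em = contradiction (All.lookup (Block.needy block) 1∈Em) ¬needy-1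
  ... | inj₂ (here 1≡x) = sym 1≡x
  ... | inj₂ (there 1∈zs) =
    contradiction (≤-trans (σ-positive x∈σ) (≤-pred (All.lookup (closing-minimal block) 1∈zs))) λ ()
    where
    x∈σ : nth σ m ∈ σ
    x∈σ = subst (nth σ m ∈_) (sym (block-split block)) (∈-++⁺ʳ (take m σ) (here refl))

  quesadilla-bucketed : bucketed (quesadillaCalls r σ) ≡ needyCount (f σ 1)
  quesadilla-bucketed with m≤n⇒m<n∨m≡n (z≤n {r})
  ... | inj₂ refl rewrite drop-r = refl
  ... | inj₁ 0<r with scan-block 0<r
  ...   | m , scan≡ , block = begin
    bucketed (loop (suc r) 0)
      ≡⟨ cong bucketed (trans (loop-unfold r σ {r} 0<r) (cong (λ k → emit 0 k ++ loop r (suc k)) scan≡)) ⟩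
    bucketed (emit 0 m ++ loop r (suc m))
      ≡⟨ bucketed-++ (emit 0 m) _ ⟩
    bucketed (emit 0 m) + bucketed (loop r (suc m))
      ≡⟨ cong₂ _+_ first-nonbucketed (loop-bucketed r (suc m) (Block.bounded block) (m≤m+n r (suc m)) (s≤s z≤n)) ⟩
    needyCount (drop (suc m) σ)
      ≡⟨ cong needyCount (sym after-1) ⟩
    needyCount (f σ 1) ∎
    where
    open ≡-Reasoning
    first-nonbucketed : bucketed (emit 0 m) ≡ 0
    first-nonbucketed = trans (cong bucketed (emit-block r σ 0 m (<⇒≤ (<r⇒<length-σ (Block.bounded block)))))
                              (bucketed-nonbucketed (reverse (take m σ)))
    after-1 : f σ 1 ≡ drop (suc m) σ
    after-1 = trans (cong (f σ) (sym (first-block-closes-at-1 block)))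
                    (f-nth m σ-unique (<r⇒<length-σ (Block.bounded block)))

theorem3p6 : (r : ℕ) (σ : List ℕ) → σ ↭ simple r →
    Transforms r σ (quesadillaCalls r σ)
    × ((cs : List Call) → Transforms r σ cs → length (quesadillaCalls r σ) ≤ length cs)
    × ((cs : List Call) → Transforms r σ cs → length cs ≡ length (quesadillaCalls r σ) →
         bucketed (quesadillaCalls r σ) ≤ bucketed cs)
theorem3p6 r σ σ↭S =
  quesadilla-transforms σ↭S ,
  (λ cs transforms → subst (_≤ length cs) (sym (quesadilla-length σ↭S)) (length-lower-bound σ↭S transforms)) ,
  (λ cs transforms shortest → subst (_≤ bucketed cs) (sym (quesadilla-bucketed σ↭S))
     (shortest⇒bucketed-lower-bound σ↭S transforms (trans shortest (quesadilla-length σ↭S))))
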